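{- Let $T$ and $S$ be acyclic $d$-tournaments on the vertex set $[n]$ with the same degree sequence. Then $T=S$. (That is, an acyclic $d$-tournament is uniquely determined by its degree sequence.)
   Context: Let $V=[n]$ with its natural order. A $d$-tournament on $V$ is a map $\epsilon:\binom{V}{d+1}\to\{ -1,1\}$, $\sigma\mapsto\epsilon_\sigma$ (elements of $\binom V{d+1}$ are called $d$-faces). For $\sigma=\{i_0<\dots<i_d\}$ and $\tau=\sigma\setminus\{i_j\}$ put $(\tau;\sigma)=(-1)^{d-j}$, and $(\tau;\sigma)=0$ if $\tau\not\subset\sigma$. The incidence matrix $A$ is the $\binom nd\times\binom n{d+1}$ matrix with entries $A_{\tau,\sigma}=\epsilon_\sigma(\tau;\sigma)$ ($\tau$ ranging over $d$-subsets, $\sigma$ over $(d+1)$-subsets). The degree sequence of the tournament is the vector $A\cdot\vec 1\in\mathbb Z^{\binom nd}$, where $\vec1$ is the all-ones vector of length $\binom n{d+1}$. A nonempty set $C$ of $d$-faces is a cycle if there exist positive reals $v_F$ ($F\in C$) with $\sum_{F\in C}v_FA_{*,F}=0$, where $A_{*,F}$ is the column of $F$. The tournament is acyclic if it has no cycle. -}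

module Defs where

open import Data.Nat as ℕ using (ℕ; zero; suc)
open import Data.Bool using (Bool; true; false; if_then_else_)
open import Data.Fin using (Fin; _<?_)
open import Data.Fin.Subset using (Subset; ∣_∣; inside; outside)
open import Data.Vec using (Vec; []; _∷_; lookup; _[_]≔_)
open import Data.Vec.Properties using (≡-dec)
import Data.Bool.Properties as BoolP
open import Data.List as List using (List; []; _∷_; _++_; filter; map; allFin; foldr)
open import Data.Integer as ℤ using (ℤ; +_; -[1+_])
open import Data.Sign using (Sign)
open import Data.Rational as ℚ using (ℚ; 0ℚ)
open import Relation.Nullary using (Dec; yes; no; does)
open import Relation.Binary.PropositionalEquality using (_≡_)
open import Data.Product using (Σ; ∃; _×_)
open import Relation.Nullary using (¬_)

-- Vertex set [n] is modelled as Fin n (natural order on Fin n).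
-- A k-subset of [n] is a Subset n (Vec Bool n) with ∣ σ ∣ ≡ k.

allSubsets : (n : ℕ) → List (Subset n)
allSubsets zero    = [] ∷ []
allSubsets (suc n) = map (outside ∷_) (allSubsets n) ++ map (inside ∷_) (allSubsets n)

kSubsets : (n k : ℕ) → List (Subset n)
kSubsets n k = filter (λ σ → ∣ σ ∣ ℕ.≟ k) (allSubsets n)

faces : (n d : ℕ) → List (Subset n)
faces n d = kSubsets n (suc d)

-- a d-tournament: a sign for each subset; only its values on d-faces
-- (i.e. (d+1)-subsets) are relevant
Tournament : ℕ → Set
Tournament n = Subset n → Sign

sumℤ : List ℤ → ℤ
sumℤ = foldr ℤ._+_ (+ 0)

sumℕ : List ℕ → ℕ
sumℕ = foldr ℕ._+_ 0

sumℚ : List ℚ → ℚ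
sumℚ = foldr ℚ._+_ 0ℚ

signPow : ℕ → ℤ
signPow zero    = + 1
signPow (suc k) = ℤ.- signPow k

-- number of elements of σ strictly greater than i
-- (if σ = {i_0 < ... < i_d} and i = i_j this is d - j)
above : {n : ℕ} → Subset n → Fin n → ℕ
above {n} σ i = sumℕ (map (λ k → if does (i <? k) then (if lookup σ k then 1 else 0) else 0) (allFin n))

-- the incidence number (τ;σ): (-1)^{d-j} if τ = σ ∖ {i_j}, and 0 otherwise
incidence : {n : ℕ} → Subset n → Subset n → ℤ
incidence {n} τ σ = sumℤ (map term (allFin n))
  where
  term : Fin n → ℤ
  term i with lookup σ i | ≡-dec BoolP._≟_ τ (σ [ i ]≔ outside)
  ... | true  | yes _ = signPow (above σ i)
  ... | _     | _     = + 0

A : {n : ℕ} → Tournament n → Subset n → Subset n → ℤ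
A ε τ σ = (ε σ ℤ.◃ 1) ℤ.* incidence τ σ

degree : {n : ℕ} (d : ℕ) → Tournament n → Subset n → ℤ
degree {n} d ε τ = sumℤ (map (λ σ → A ε τ σ) (faces n d))

SameDegreeSequence : {n : ℕ} (d : ℕ) → Tournament n → Tournament n → Set
SameDegreeSequence {n} d ε ε' = ∀ (τ : Subset n) → ∣ τ ∣ ≡ d → degree d ε τ ≡ degree d ε' τ

-- A cycle: a nonempty set C of d-faces with positive weights v_F (F ∈ C)
-- such that Σ_{F ∈ C} v_F A_{*,F} = 0.  The set C is encoded by its
-- weight function v (C = support of v): v is ≥ 0 on all d-faces, positive
-- on some d-face, and the weighted column sum vanishes in every row τ.
IsCycleWeight : {n : ℕ} (d : ℕ) → Tournament n → (Subset n → ℚ) → Set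
IsCycleWeight {n} d ε v =
    (∀ (σ : Subset n) → ∣ σ ∣ ≡ suc d → 0ℚ ℚ.≤ v σ)
  × (∃ λ (σ : Subset n) → (∣ σ ∣ ≡ suc d) × (0ℚ ℚ.< v σ))
  × (∀ (τ : Subset n) → ∣ τ ∣ ≡ d →
       sumℚ (map (λ σ → v σ ℚ.* (A ε τ σ ℚ./ 1)) (faces n d)) ≡ 0ℚ)

HasCycle : {n : ℕ} (d : ℕ) → Tournament n → Set
HasCycle d ε = ∃ λ v → IsCycleWeight d ε v

Acyclic : {n : ℕ} (d : ℕ) → Tournament n → Set
Acyclic d ε = ¬ HasCycle d ε

SameTournament : {n : ℕ} (d : ℕ) → Tournament n → Tournament n → Set
SameTournament {n} d ε ε' = ∀ (σ : Subset n) → ∣ σ ∣ ≡ suc d → ε σ ≡ ε' σ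

-- Where two tournaments disagree on a face their columns are opposite, so
-- A_T·1 − A_S·1 = 2 Σ_{T σ ≠ S σ} A_{*,σ}(T).  Equal degree sequences make this
-- sum vanish, i.e. the faces on which T and S disagree, each with weight 1,
-- form a cycle of T.  Hence acyclicity of T alone forces T = S.
module Submission where

open import Defs
open import Data.Nat using (ℕ)

import Data.Nat as ℕ
open import Data.Integer as ℤ using (ℤ; +_; -[1+_]; _◃_)
import Data.Integer.Properties as ℤP
open import Data.Integer.Tactic.RingSolver using (solve-∀)
open import Algebra.Properties.AbelianGroup ℤP.+-0-abelianGroup using (identityʳ-unique)
open import Data.Fin.Subset using (Subset; ∣_∣)
open import Data.List using (List; []; _∷_; map)
open import Data.List.Properties using (map-cong)
open import Data.Nat.Coprimality as Coprimality using (Coprime)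
open import Data.Product using (_,_)
open import Data.Rational as ℚ using (mkℚ; 0ℚ)
import Data.Rational.Properties as ℚP
open import Data.Sign as Sign using (Sign)
import Data.Sign.Properties as SignP
open import Relation.Binary.PropositionalEquality
open import Relation.Nullary using (yes; no; contradiction)

private
  variable
    X : Set

coprime-1 : ∀ m → Coprime m 1
coprime-1 m = Coprimality.sym (Coprimality.1-coprimeTo m)

/1≡mkℚ : ∀ a → a ℚ./ 1 ≡ mkℚ a 0 (coprime-1 ℤ.∣ a ∣)
/1≡mkℚ (+ n)    = ℚP.normalize-coprime (coprime-1 n)
/1≡mkℚ -[1+ n ] = cong ℚ.-_ (ℚP.normalize-coprime (coprime-1 (ℕ.suc n)))

/1-homo-+ : ∀ a b → (a ℚ./ 1) ℚ.+ (b ℚ./ 1) ≡ (a ℤ.+ b) ℚ./ 1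
/1-homo-+ a b rewrite /1≡mkℚ a | /1≡mkℚ b | ℤP.*-identityʳ a | ℤP.*-identityʳ b = refl

/1-homo-* : ∀ a b → (a ℚ./ 1) ℚ.* (b ℚ./ 1) ≡ (a ℤ.* b) ℚ./ 1
/1-homo-* a b rewrite /1≡mkℚ a | /1≡mkℚ b = refl

sumℚ-map-/1 : (f : X → ℤ) (xs : List X) →
  sumℚ (map (λ x → f x ℚ./ 1) xs) ≡ sumℤ (map f xs) ℚ./ 1
sumℚ-map-/1 f []       = refl
sumℚ-map-/1 f (x ∷ xs) rewrite sumℚ-map-/1 f xs = /1-homo-+ (f x) (sumℤ (map f xs))

sumℤ-map-+ : (f g : X → ℤ) (xs : List X) →
  sumℤ (map (λ x → f x ℤ.+ g x) xs) ≡ sumℤ (map f xs) ℤ.+ sumℤ (map g xs)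
sumℤ-map-+ f g []       = refl
sumℤ-map-+ f g (x ∷ xs) rewrite sumℤ-map-+ f g xs =
  interchange (f x) (g x) (sumℤ (map f xs)) (sumℤ (map g xs))
  where
  interchange : ∀ a b c d → (a ℤ.+ b) ℤ.+ (c ℤ.+ d) ≡ (a ℤ.+ c) ℤ.+ (b ℤ.+ d)
  interchange = solve-∀

sumℤ-map-*ˡ : (c : ℤ) (f : X → ℤ) (xs : List X) →
  sumℤ (map (λ x → c ℤ.* f x) xs) ≡ c ℤ.* sumℤ (map f xs)
sumℤ-map-*ˡ c f []       = sym (ℤP.*-zeroʳ c)
sumℤ-map-*ˡ c f (x ∷ xs) rewrite sumℤ-map-*ˡ c f xs = sym (ℤP.*-distribˡ-+ c (f x) (sumℤ (map f xs)))

disagreement : Sign → Sign → ℤ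
disagreement s t with s SignP.≟ t
... | yes _ = + 0
... | no  _ = + 1

disagreement-≢ : ∀ {s t} → s ≢ t → disagreement s t ≡ + 1
disagreement-≢ {s} {t} s≢t with s SignP.≟ t
... | yes s≡t = contradiction s≡t s≢t
... | no  _   = refl

0≤disagreement : ∀ s t → 0ℚ ℚ.≤ disagreement s t ℚ./ 1
0≤disagreement s t with s SignP.≟ t
... | yes _ = ℚP.≤-refl
... | no  _ = ℚ.*≤* (ℤ.+≤+ ℕ.z≤n)

◃-decompose : ∀ s t x →
  (s ◃ 1) ℤ.* x ≡ (t ◃ 1) ℤ.* x ℤ.+ + 2 ℤ.* (disagreement s t ℤ.* ((s ◃ 1) ℤ.* x))
◃-decompose Sign.- Sign.- = solve-∀
◃-decompose Sign.- Sign.+ = solve-∀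
◃-decompose Sign.+ Sign.- = solve-∀
◃-decompose Sign.+ Sign.+ = solve-∀

module _ {n : ℕ} (d : ℕ) (T S : Tournament n) where

  disagreementOn : Subset n → ℤ
  disagreementOn ρ = disagreement (T ρ) (S ρ)

  disagreementSum : Subset n → ℤ
  disagreementSum τ = sumℤ (map (λ ρ → disagreementOn ρ ℤ.* A T τ ρ) (faces n d))

  degree-decompose : ∀ τ → degree d T τ ≡ degree d S τ ℤ.+ + 2 ℤ.* disagreementSum τ
  degree-decompose τ = begin
    degree d T τ
      ≡⟨ cong sumℤ (map-cong (λ ρ → ◃-decompose (T ρ) (S ρ) (incidence τ ρ)) (faces n d)) ⟩
    sumℤ (map (λ ρ → A S τ ρ ℤ.+ + 2 ℤ.* (disagreementOn ρ ℤ.* A T τ ρ)) (faces n d))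
      ≡⟨ sumℤ-map-+ (A S τ) _ (faces n d) ⟩
    degree d S τ ℤ.+ sumℤ (map (λ ρ → + 2 ℤ.* (disagreementOn ρ ℤ.* A T τ ρ)) (faces n d))
      ≡⟨ cong (ℤ._+_ (degree d S τ)) (sumℤ-map-*ˡ (+ 2) _ (faces n d)) ⟩
    degree d S τ ℤ.+ + 2 ℤ.* disagreementSum τ ∎
    where open ≡-Reasoning

  disagreementSum≡0 : SameDegreeSequence d T S → ∀ τ → ∣ τ ∣ ≡ d → disagreementSum τ ≡ + 0
  disagreementSum≡0 sameDegree τ ∣τ∣ = ℤP.*-cancelˡ-≡ (+ 2) _ _ (trans twice≡0 (sym (ℤP.*-zeroʳ (+ 2))))
    where
    twice≡0 : + 2 ℤ.* disagreementSum τ ≡ + 0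
    twice≡0 = identityʳ-unique (degree d S τ) _
      (trans (sym (degree-decompose τ)) (sameDegree τ ∣τ∣))

  disagreement-isCycleWeight : SameDegreeSequence d T S → ∀ σ → ∣ σ ∣ ≡ ℕ.suc d → T σ ≢ S σ →
    IsCycleWeight d T (λ ρ → disagreementOn ρ ℚ./ 1)
  disagreement-isCycleWeight sameDegree σ ∣σ∣ Tσ≢Sσ =
    (λ ρ _ → 0≤disagreement (T ρ) (S ρ)) , (σ , ∣σ∣ , 0<disagreementOnσ) , balanced
    where
    0<disagreementOnσ : 0ℚ ℚ.< disagreementOn σ ℚ./ 1
    0<disagreementOnσ rewrite disagreement-≢ Tσ≢Sσ = ℚ.*<* (ℤ.+<+ (ℕ.s≤s ℕ.z≤n))

    balanced : ∀ τ → ∣ τ ∣ ≡ d →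
      sumℚ (map (λ ρ → (disagreementOn ρ ℚ./ 1) ℚ.* (A T τ ρ ℚ./ 1)) (faces n d)) ≡ 0ℚ
    balanced τ ∣τ∣ = begin
      sumℚ (map (λ ρ → (disagreementOn ρ ℚ./ 1) ℚ.* (A T τ ρ ℚ./ 1)) (faces n d))
        ≡⟨ cong sumℚ (map-cong (λ ρ → /1-homo-* (disagreementOn ρ) (A T τ ρ)) (faces n d)) ⟩
      sumℚ (map (λ ρ → (disagreementOn ρ ℤ.* A T τ ρ) ℚ./ 1) (faces n d))
        ≡⟨ sumℚ-map-/1 _ (faces n d) ⟩
      disagreementSum τ ℚ./ 1
        ≡⟨ cong (ℚ._/ 1) (disagreementSum≡0 sameDegree τ ∣τ∣) ⟩
      0ℚ ∎
      where open ≡-Reasoning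

mainTheorem4 : (n d : ℕ) (T S : Tournament n) →
    Acyclic d T → Acyclic d S → SameDegreeSequence d T S → SameTournament d T S
mainTheorem4 n d T S acyclicT _ sameDegree σ ∣σ∣ with T σ SignP.≟ S σ
... | yes Tσ≡Sσ = Tσ≡Sσ
... | no  Tσ≢Sσ =
  contradiction (_ , disagreement-isCycleWeight d T S sameDegree σ ∣σ∣ Tσ≢Sσ) acyclicT
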